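{- Let $P$ be an RB-template and $P^{\multimap}$ its reachability-unwinding, viewed as an LTS with labeling $\lambda^{\multimap}$. Then (1) $\mathrm{exec}_{fin}(P^\infty)=\{\lambda^{\multimap}(\pi):\pi\text{ a finite run of }P^{\multimap}\}$, and (2) $\mathrm{exec}_{inf}(P^\infty)\subseteq\{\lambda^{\multimap}(\pi):\pi\text{ an infinite run of }P^{\multimap}\}$.
   Context: Fix $k\ge1$, finite $\Sigma_{actn}$, $\Sigma_{rdz}=\{a_1,\dots,a_k:a\in\Sigma_{actn}\}$ and broadcast symbol $\mathfrak{b}$. An RB-template is a finite LTS $P=(AP,\Sigma_{rdz}\cup\{\mathfrak{b}\},S,I,R,\lambda)$ with an outgoing $\mathfrak{b}$-edge from every state. A run of an LTS is a finite or infinite sequence of edges $e_1e_2\cdots$ starting in an initial state with consecutive edges matching; its label sequence is $\lambda(\mathrm{src}(e_1))\cdots\lambda(\mathrm{src}(e_m))\lambda(\mathrm{dst}(e_m))$ if finite with $m$ edges, and $\lambda(\mathrm{src}(e_1))\lambda(\mathrm{src}(e_2))\cdots$ if infinite. The RB-system $P^n$ has configurations $f:[n]\to S$ (initial if all $f(i)\in I$), broadcast transitions where every process $i$ moves along an edge $(f(i),\mathfrak{b},g(i))\in R$, and rendezvous transitions where for some $a\in\Sigma_{actn}$ and pairwise distinct $i_1,\dots,i_k$, each $i_j$ moves along an edge $(f(i_j),a_j,g(i_j))\in R$ and the others stay. For a run $\pi$ of $P^n$, $\mathrm{proj}_\pi(1)$ is the sequence of edges of $P$ taken by process 1 in transitions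 in which it moves. $\mathrm{exec}(P^\infty)$ is the set of label sequences $\lambda(\mathrm{proj}_\pi(1))$ over runs $\pi$ of all $P^n$; $\mathrm{exec}_{fin}$ and $\mathrm{exec}_{inf}$ are its finite and infinite words. Reachability-unwinding: $I_0=I$; given $I_i$, $S_i,R_i$ are the least sets with $I_i\subseteq S_i$, $R_i$ consisting of rendezvous edges of $R$, closed under: if $(s,a_h,t)\in R$, $s\in S_i$, and for each $l\in[k]\setminus\{h\}$ some edge $(s',a_l,t')\in R$ has $s'\in S_i$, then $(s,a_h,t)\in R_i$ and $t\in S_i$; $I_{i+1}=\{s:(h,\mathfrak{b},s)\in R, h\in S_i\}$. Let $m$ be least with $I_{m+1}=I_n$ for some $n\le m$. $P^{\multimap}$ has states $(s,i)$ with $0\le i\le m$, $s\in S_i$; initial states $(s,0)$, $s\in I$; labels $\lambda^{\multimap}(s,i)=\lambda(s)$; rendezvous edges $((s,i),\sigma,(t,i))$ for $(s,\sigma,t)\in R_i$; broadcast edges $((s,i),\mathfrak{b},(t,i+1))$ for $i<m$, $s\in S_i$, $(s,\mathfrak{b},t)\in R$, and $((s,m),\mathfrak{b},(t,n))$ for $s\in S_m$, $(s,\mathfrak{b},t)\in R$. -}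

module Defs where

open import Data.Nat using (ℕ; zero; suc; _≤_; _<_)
open import Data.Fin using (Fin; zero; suc; toℕ; _≟_)
open import Data.Fin.Properties using (any?)
open import Data.Fin.Subset using (Subset)
open import Data.Bool using (Bool; true; false)
open import Data.List using (List; []; _∷_; map; mapMaybe; allFin; upTo)
open import Data.Maybe using (Maybe; just; nothing)
open import Data.Product using (Σ; ∃; ∃-syntax; _×_; _,_; proj₁; proj₂)
open import Data.Sum using (_⊎_)
open import Relation.Nullary using (¬_; yes; no)
open import Relation.Binary.PropositionalEquality using (_≡_; _≢_)
open import Function.Definitions using (Injective)

-- Edge symbols  Σ_rdz ∪ {𝔟}, with Σ_actn = Fin nA and a_j written  rdz a j
-- (j : Fin k, i.e. j ∈ [k]).

data Sym (k nA : ℕ) : Set where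
  rdz   : Fin nA → Fin k → Sym k nA
  bcast : Sym k nA

record RBTemplate (k nA : ℕ) : Set where
  field
    nAP   : ℕ
    nS    : ℕ
    Init  : Fin nS → Bool
    Rel   : Fin nS → Sym k nA → Fin nS → Bool
    lab   : Fin nS → Subset nAP
    bcastTotal : ∀ s → ∃[ t ] Rel s bcast t ≡ true

record LTS (k nA : ℕ) (Lab : Set) : Set₁ where
  field
    St   : Set
    IsInit : St → Set
    Edge : St → Sym k nA → St → Set
    lab  : St → Lab

module _ {k nA : ℕ} {Lab : Set} (T : LTS k nA Lab) where
  open LTS T

  record FinRun : Set where
    field
      len  : ℕ
      st   : ℕ → St
      sym  : ℕ → Sym k nA
      init : IsInit (st 0)
      edge : (i : Fin len) → Edge (st (toℕ i)) (sym (toℕ i)) (st (suc (toℕ i)))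

  -- label sequence λ(src e_1) ⋯ λ(src e_m) λ(dst e_m)
  finLabels : FinRun → List Lab
  finLabels π = map (λ i → lab (FinRun.st π i)) (upTo (suc (FinRun.len π)))

  record InfRun : Set where
    field
      st   : ℕ → St
      sym  : ℕ → Sym k nA
      init : IsInit (st 0)
      edge : (i : ℕ) → Edge (st i) (sym i) (st (suc i))

  infLabels : InfRun → ℕ → Lab
  infLabels π i = lab (InfRun.st π i)

-- RB-systems P^N (with N processes, process 1 being  zero : Fin N).

module RB {k nA : ℕ} (P : RBTemplate k nA) where
  open RBTemplate P

  Lab : Set
  Lab = Subset nAP

  Conf : ℕ → Set
  Conf N = Fin N → Fin nS

  IsInitConf : ∀ {N} → Conf N → Set
  IsInitConf f = ∀ i → Init (f i) ≡ true

  data Trans {N : ℕ} (f g : Conf N) : Set where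
    bc : (∀ i → Rel (f i) bcast (g i) ≡ true) → Trans f g
    rz : (a : Fin nA) (ι : Fin k → Fin N) → Injective _≡_ _≡_ ι
       → (∀ j → Rel (f (ι j)) (rdz a j) (g (ι j)) ≡ true)
       → (∀ i → (∀ j → ι j ≢ i) → g i ≡ f i)
       → Trans f g

  PEdge : Set
  PEdge = Fin nS × Sym k nA × Fin nS

  src dst : PEdge → Fin nS
  src e = proj₁ e
  dst e = proj₂ (proj₂ e)

  move1 : ∀ {N} {f g : Conf (suc N)} → Trans f g → Maybe (Sym k nA)
  move1 (bc _) = just bcast
  move1 (rz a ι _ _ _) with any? (λ j → ι j ≟ zero)
  ... | yes (j , _) = just (rdz a j)
  ... | no _ = nothing

  edge1 : ∀ {N} {f g : Conf (suc N)} → Trans f g → Maybe PEdge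
  edge1 {f = f} {g} t with move1 t
  ... | just σ = just (f zero , σ , g zero)
  ... | nothing = nothing

  -- finite runs of P^N (process count N ≥ 1, written suc N)
  record SysFinRun (N : ℕ) : Set where
    field
      len  : ℕ
      conf : ℕ → Conf (suc N)
      init : IsInitConf (conf 0)
      tr   : (i : Fin len) → Trans (conf (toℕ i)) (conf (suc (toℕ i)))

  record SysInfRun (N : ℕ) : Set where
    field
      conf : ℕ → Conf (suc N)
      init : IsInitConf (conf 0)
      tr   : (i : ℕ) → Trans (conf i) (conf (suc i))

  prefix : ∀ {N} → SysInfRun N → ℕ → SysFinRun N
  prefix π L = record
    { len = L ; conf = SysInfRun.conf π ; init = SysInfRun.init π
    ; tr = λ i → SysInfRun.tr π (toℕ i) }

  projFin : ∀ {N} → SysFinRun N → List PEdge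
  projFin π = mapMaybe (λ i → edge1 (SysFinRun.tr π i)) (allFin (SysFinRun.len π))

  edgeLabels : Fin nS → List PEdge → List Lab
  edgeLabels s₀ [] = lab s₀ ∷ []
  edgeLabels s₀ (e ∷ es) = lab (src e) ∷ edgeLabels (dst e) es

  finProjLabels : ∀ {N} → SysFinRun N → List Lab
  finProjLabels π = edgeLabels (SysFinRun.conf π 0 zero) (projFin π)

  -- exec_fin(P^∞): finite label sequences of proj_π(1), π a (finite or
  -- infinite) run of some P^N in which process 1 moves only finitely often.
  ExecFin : List Lab → Set
  ExecFin w =
      (∃[ N ] Σ (SysFinRun N) λ π → finProjLabels π ≡ w)
    ⊎ (∃[ N ] Σ (SysInfRun N) λ π → ∃[ L ]
         ((∀ i → L ≤ i → move1 (SysInfRun.tr π i) ≡ nothing)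
          × finProjLabels (prefix π L) ≡ w))

  -- exec_inf(P^∞): π an infinite run in which process 1 moves infinitely
  -- often, exactly at the (strictly increasing) transition indices  idx 0, idx 1, …;
  -- proj_π(1) = e_0 e_1 ⋯ with e_j = (conf (idx j) 1, σ_j, conf (idx j + 1) 1),
  -- and the label sequence is λ(src e_0) λ(src e_1) ⋯.
  ExecInf : (ℕ → Lab) → Set
  ExecInf w = ∃[ N ] Σ (SysInfRun N) λ π → Σ (ℕ → ℕ) λ idx →
      (∀ j → idx j < idx (suc j))
    × (∀ j → ∃[ σ ] move1 (SysInfRun.tr π (idx j)) ≡ just σ)
    × (∀ i → (∀ j → idx j ≢ i) → move1 (SysInfRun.tr π i) ≡ nothing)
    × (∀ j → w j ≡ lab (SysInfRun.conf π (idx j) zero))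

module Unwinding {k nA : ℕ} (P : RBTemplate k nA) where
  open RBTemplate P

  data SReach (Ini : Fin nS → Set) : Fin nS → Set where
    base : ∀ {s} → Ini s → SReach Ini s
    step : ∀ {s t} (a : Fin nA) (h : Fin k)
         → Rel s (rdz a h) t ≡ true → SReach Ini s
         → (∀ l → l ≢ h → ∃[ s' ] ∃[ t' ] (Rel s' (rdz a l) t' ≡ true × SReach Ini s'))
         → SReach Ini t

  REdge : (Fin nS → Set) → Fin nS → Sym k nA → Fin nS → Set
  REdge Ini s σ t = ∃[ a ] ∃[ h ]
      (σ ≡ rdz a h × Rel s (rdz a h) t ≡ true × SReach Ini s
       × (∀ l → l ≢ h → ∃[ s' ] ∃[ t' ] (Rel s' (rdz a l) t' ≡ true × SReach Ini s')))

  ISet : ℕ → Fin nS → Set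
  ISet zero s = Init s ≡ true
  ISet (suc i) s = ∃[ h ] (SReach (ISet i) h × Rel h bcast s ≡ true)

  SSet : ℕ → Fin nS → Set
  SSet i = SReach (ISet i)

  SameSet : (Fin nS → Set) → (Fin nS → Set) → Set
  SameSet A B = ∀ s → (A s → B s) × (B s → A s)

  IsLoopPoint : ℕ → ℕ → Set
  IsLoopPoint m n = n ≤ m × SameSet (ISet (suc m)) (ISet n)
                  × (∀ m' n' → m' < m → n' ≤ m' → ¬ SameSet (ISet (suc m')) (ISet n'))

  module _ (m n : ℕ) where
    record UState : Set where
      constructor ⟨_,_⟩
      field
        s   : Fin nS
        idx : ℕ
        idx≤m : idx ≤ m
        inS : SSet idx s

    data UEdge (x : UState) : Sym k nA → UState → Set where
      rdzE : ∀ {σ y} → UState.idx y ≡ UState.idx x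
           → REdge (ISet (UState.idx x)) (UState.s x) σ (UState.s y) → UEdge x σ y
      bcE  : ∀ {y} → Rel (UState.s x) bcast (UState.s y) ≡ true
           → ((UState.idx x < m × UState.idx y ≡ suc (UState.idx x))
              ⊎ (UState.idx x ≡ m × UState.idx y ≡ n))
           → UEdge x bcast y

    Unwound : LTS k nA (Subset nAP)
    Unwound = record
      { St = UState
      ; IsInit = λ x → UState.idx x ≡ 0 × Init (UState.s x) ≡ true
      ; Edge = UEdge
      ; lab = λ x → lab (UState.s x) }

-- Soundness: along any run of P^N, every process stays inside the current S_i,
-- where i advances at each broadcast (wrapping from m to n, as I_{m+1} = I_n);
-- hence the moves of process 1 are edges of P^⊸.
-- Completeness: a finite run of P^⊸ is replayed by process 1 in a large enough P^N.
-- Every state of S_i is reachable from I_i by a tree of rendezvous, so enough helper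
-- processes started in I_i can be steered, silently for process 1, into the states
-- of the partners needed by the next rendezvous of process 1.  Helpers for later
-- phases are pushed along by the broadcasts of earlier ones.
module Submission where

open import Defs
open import Data.Nat using (ℕ; zero; suc; _+_; _≤_; _<_; _≤′_; ≤′-refl; ≤′-step; z≤n; _≤?_)
open import Data.Nat.Properties
  using (≤-refl; ≤-trans; <⇒≤; m≤n⇒m<n∨m≡n; ≤⇒≯; ≰⇒>; ≤′⇒≤; ≤⇒≤′; n<1+n; m<n⇒m<1+n)
open import Data.Fin using (Fin; zero; suc; toℕ; _≟_; _↑ˡ_; _↑ʳ_; splitAt)
open import Data.Fin.Properties
  using (any?; splitAt⁻¹-↑ˡ; splitAt⁻¹-↑ʳ; ↑ˡ-injective; ↑ʳ-injective; suc-injective)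
open import Data.Fin.Subset using (Subset)
open import Data.Vec.Functional using () renaming (_++_ to _++ᵛ_)
open import Data.Vec.Functional.Properties using (lookup-++ˡ; lookup-++ʳ)
open import Data.List using (List; []; _∷_; _++_; _?∷_; map; mapMaybe; catMaybes; allFin; applyUpTo)
open import Data.List.Properties using (map-tabulate; map-applyUpTo)
open import Data.Bool using (true)
open import Data.Maybe using (Maybe; just; nothing)
open import Data.Product using (Σ; ∃; ∃-syntax; _×_; _,_; proj₁; proj₂)
open import Data.Sum using (_⊎_; inj₁; inj₂)
open import Data.Empty using (⊥-elim)
open import Function using (_∘_; id)
open import Function.Definitions using (Injective)
open import Relation.Nullary using (Dec; yes; no)
open import Relation.Binary.PropositionalEquality
  using (_≡_; _≢_; refl; sym; trans; cong; cong₂; subst; subst₂)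
open import Relation.Binary.Construct.Closure.ReflexiveTransitive using (Star; ε; _◅_; _◅◅_)

mapMaybe-allFin-suc : ∀ {A : Set} {L} (f : Fin (suc L) → Maybe A) →
                      mapMaybe f (allFin (suc L)) ≡ f zero ?∷ mapMaybe (f ∘ suc) (allFin L)
mapMaybe-allFin-suc f =
  cong (λ xs → f zero ?∷ catMaybes xs) (trans (map-tabulate suc f) (sym (map-tabulate id (f ∘ suc))))

?∷-++ : ∀ {A : Set} (x : Maybe A) (xs ys : List A) → (x ?∷ xs) ++ ys ≡ x ?∷ (xs ++ ys)
?∷-++ (just _) _ _ = refl
?∷-++ nothing  _ _ = refl

↑ˡ≢↑ʳ : ∀ {a b} (i : Fin a) (j : Fin b) → i ↑ˡ b ≢ a ↑ʳ j
↑ˡ≢↑ʳ zero    j ()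
↑ˡ≢↑ʳ (suc i) j eq = ↑ˡ≢↑ʳ i j (suc-injective eq)

++ᵛ-injective : ∀ {B : Set} {M₁ M₂} {f : Fin M₁ → B} {g : Fin M₂ → B} →
                Injective _≡_ _≡_ f → Injective _≡_ _≡_ g → (∀ a b → f a ≢ g b) →
                Injective _≡_ _≡_ (f ++ᵛ g)
++ᵛ-injective {M₁ = M₁} {M₂} f-inj g-inj f#g {x} {y} eq
  with splitAt M₁ x in x≡ | splitAt M₁ y in y≡
... | inj₁ a | inj₁ b =
  trans (sym (splitAt⁻¹-↑ˡ x≡)) (trans (cong (_↑ˡ M₂) (f-inj eq)) (splitAt⁻¹-↑ˡ y≡))
... | inj₁ a | inj₂ b = ⊥-elim (f#g a b eq)
... | inj₂ a | inj₁ b = ⊥-elim (f#g b a (sym eq))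
... | inj₂ a | inj₂ b =
  trans (sym (splitAt⁻¹-↑ʳ x≡)) (trans (cong (M₁ ↑ʳ_) (g-inj eq)) (splitAt⁻¹-↑ʳ y≡))

module IndexedPaths {A : Set} {T : A → A → Set} where

  fromIndexed : ∀ L (st : ℕ → A) → ((i : Fin L) → T (st (toℕ i)) (st (suc (toℕ i)))) →
                Star T (st 0) (st L)
  fromIndexed zero    st tr = ε
  fromIndexed (suc L) st tr = tr zero ◅ fromIndexed L (st ∘ suc) (tr ∘ suc)

  length : ∀ {a b} → Star T a b → ℕ
  length ε       = 0
  length (_ ◅ π) = suc (length π)

  stateAt : ∀ {a b} → Star T a b → ℕ → A
  stateAt {a} ε       _       = a
  stateAt {a} (_ ◅ _) zero    = a
  stateAt     (_ ◅ π) (suc i) = stateAt π i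

  stateAt-0 : ∀ {a b} (π : Star T a b) → stateAt π 0 ≡ a
  stateAt-0 ε       = refl
  stateAt-0 (_ ◅ _) = refl

  stepAt : ∀ {a b} (π : Star T a b) (i : Fin (length π)) →
           T (stateAt π (toℕ i)) (stateAt π (suc (toℕ i)))
  stepAt (t ◅ ε)       zero    = t
  stepAt (t ◅ (_ ◅ _)) zero    = t
  stepAt (_ ◅ π)       (suc i) = stepAt π i

  states : ∀ {a b} → Star T a b → List A
  states {a} ε       = a ∷ []
  states {a} (_ ◅ π) = a ∷ states π

  states-fromIndexed : ∀ L st tr → states (fromIndexed L st tr) ≡ applyUpTo st (suc L)
  states-fromIndexed zero    st tr = refl
  states-fromIndexed (suc L) st tr = cong (st 0 ∷_) (states-fromIndexed L (st ∘ suc) (tr ∘ suc))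

  states-stateAt : ∀ {a b} (π : Star T a b) → applyUpTo (stateAt π) (suc (length π)) ≡ states π
  states-stateAt ε           = refl
  states-stateAt {a} (_ ◅ π) = cong (a ∷_) (states-stateAt π)

  module _ {B : Set} (g : ∀ {a b} → T a b → Maybe B) where

    collect : ∀ {a b} → Star T a b → List B
    collect ε       = []
    collect (t ◅ π) = g t ?∷ collect π

    collect-fromIndexed : ∀ L st tr →
                          collect (fromIndexed L st tr) ≡ mapMaybe (λ i → g (tr i)) (allFin L)
    collect-fromIndexed zero    st tr = refl
    collect-fromIndexed (suc L) st tr =
      trans (cong (g (tr zero) ?∷_) (collect-fromIndexed L (st ∘ suc) (tr ∘ suc)))
            (sym (mapMaybe-allFin-suc (λ i → g (tr i))))

    collect-stepAt : ∀ {a b} (π : Star T a b) →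
                     mapMaybe (λ i → g (stepAt π i)) (allFin (length π)) ≡ collect π
    collect-stepAt ε             = refl
    collect-stepAt (t ◅ ε)       = mapMaybe-allFin-suc (λ i → g (stepAt (t ◅ ε) i))
    collect-stepAt (t ◅ (u ◅ π)) =
      trans (mapMaybe-allFin-suc (λ i → g (stepAt (t ◅ (u ◅ π)) i)))
            (cong (g t ?∷_) (collect-stepAt (u ◅ π)))

    collect-◅◅ : ∀ {a b c} (π : Star T a b) (ρ : Star T b c) →
                 collect (π ◅◅ ρ) ≡ collect π ++ collect ρ
    collect-◅◅ ε       ρ = refl
    collect-◅◅ (t ◅ π) ρ =
      trans (cong (g t ?∷_) (collect-◅◅ π ρ)) (sym (?∷-++ (g t) (collect π) (collect ρ)))

module Systems {k nA : ℕ} (P : RBTemplate k nA) where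
  open RBTemplate P
  open RB P
  open IndexedPaths

  Path : ∀ {N} → Conf (suc N) → Conf (suc N) → Set
  Path = Star Trans

  projPath : ∀ {N} {c d : Conf (suc N)} → Path c d → List PEdge
  projPath = collect edge1

  projPath-◅◅-silent : ∀ {N} {c d d' : Conf (suc N)} (π : Path c d) (ρ : Path d d') →
                       projPath π ≡ [] → projPath (π ◅◅ ρ) ≡ projPath ρ
  projPath-◅◅-silent π ρ silent = trans (collect-◅◅ edge1 π ρ) (cong (_++ projPath ρ) silent)

  pathOfRun : ∀ {N} (ρ : SysFinRun N) → Path (SysFinRun.conf ρ 0) (SysFinRun.conf ρ (SysFinRun.len ρ))
  pathOfRun ρ = fromIndexed len conf tr where open SysFinRun ρ

  projPath-pathOfRun : ∀ {N} (ρ : SysFinRun N) → projPath (pathOfRun ρ) ≡ projFin ρ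
  projPath-pathOfRun ρ = collect-fromIndexed edge1 len conf tr where open SysFinRun ρ

  runOfPath : ∀ {N} {c d : Conf (suc N)} → IsInitConf c → Path c d → SysFinRun N
  runOfPath ini π = record
    { len = length π ; conf = stateAt π ; init = subst IsInitConf (sym (stateAt-0 π)) ini ; tr = stepAt π }

  finProjLabels-runOfPath : ∀ {N} {c d : Conf (suc N)} (ini : IsInitConf c) (π : Path c d) →
                            finProjLabels (runOfPath ini π) ≡ edgeLabels (c zero) (projPath π)
  finProjLabels-runOfPath ini π = cong₂ edgeLabels (cong (λ f → f zero) (stateAt-0 π)) (collect-stepAt edge1 π)

  edge1-loud : ∀ {N} {f g : Conf (suc N)} (t : Trans f g) {σ} → move1 t ≡ just σ →
               edge1 t ≡ just (f zero , σ , g zero)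
  edge1-loud t moved rewrite moved = refl

  module _ {N} {f g : Conf (suc N)} (a : Fin nA) (ι : Fin k → Fin (suc N)) (ι-inj : Injective _≡_ _≡_ ι)
           (moves : ∀ j → Rel (f (ι j)) (rdz a j) (g (ι j)) ≡ true)
           (frame : ∀ i → (∀ j → ι j ≢ i) → g i ≡ f i) where

    move1≡just⇒participant : ∀ {σ} → move1 (rz a ι ι-inj moves frame) ≡ just σ →
                             ∃[ j ] (ι j ≡ zero × σ ≡ rdz a j)
    move1≡just⇒participant eq with any? (λ j → ι j ≟ zero)
    move1≡just⇒participant refl | yes (j , ι≡0) = j , ι≡0 , refl
    move1≡just⇒participant ()   | no _

    move1≡nothing⇒absent : move1 (rz a ι ι-inj moves frame) ≡ nothing → ∀ j → ι j ≢ zero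
    move1≡nothing⇒absent eq j ι≡0 with any? (λ j → ι j ≟ zero)
    move1≡nothing⇒absent () j ι≡0 | yes _
    move1≡nothing⇒absent eq j ι≡0 | no none = none (j , ι≡0)

  afterRdz : ∀ {N} → Conf (suc N) → (Fin k → Fin (suc N)) → (Fin k → Fin nS) → Conf (suc N)
  afterRdz c ι tgt p with any? (λ l → ι l ≟ p)
  ... | yes (l , _) = tgt l
  ... | no _        = c p

  afterRdz-participant : ∀ {N} (c : Conf (suc N)) {ι} tgt → Injective _≡_ _≡_ ι →
                         ∀ l → afterRdz c ι tgt (ι l) ≡ tgt l
  afterRdz-participant c {ι} tgt ι-inj l with any? (λ l' → ι l' ≟ ι l)
  ... | yes (l' , eq) = cong tgt (ι-inj eq)
  ... | no none       = ⊥-elim (none (l , refl))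

  afterRdz-bystander : ∀ {N} (c : Conf (suc N)) {ι} tgt p → (∀ l → ι l ≢ p) → afterRdz c ι tgt p ≡ c p
  afterRdz-bystander c {ι} tgt p absent with any? (λ l → ι l ≟ p)
  ... | yes (l , eq) = ⊥-elim (absent l eq)
  ... | no _         = refl

  module _ {N} (c : Conf (suc N)) {a : Fin nA} {ι : Fin k → Fin (suc N)} (ι-inj : Injective _≡_ _≡_ ι)
           {src tgt : Fin k → Fin nS} (at : ∀ l → c (ι l) ≡ src l)
           (moves : ∀ l → Rel (src l) (rdz a l) (tgt l) ≡ true) where

    rdzTrans : Trans c (afterRdz c ι tgt)
    rdzTrans = rz a ι ι-inj
      (λ l → subst₂ (λ s t → Rel s (rdz a l) t ≡ true)
                    (sym (at l)) (sym (afterRdz-participant c tgt ι-inj l)) (moves l))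
      (afterRdz-bystander c tgt)

    rdzTrans-silent : (∀ l → ι l ≢ zero) → edge1 rdzTrans ≡ nothing
    rdzTrans-silent absent with any? (λ l → ι l ≟ zero)
    ... | yes (l , ι≡0) = ⊥-elim (absent l ι≡0)
    ... | no _          = refl

    rdzTrans-moves1 : ∀ l → ι l ≡ zero → ∃[ σ ] move1 rdzTrans ≡ just σ
    rdzTrans-moves1 l ι≡0 with any? (λ l → ι l ≟ zero)
    ... | yes _   = _ , refl
    ... | no none = ⊥-elim (none (l , ι≡0))

  afterBc : ∀ {N M} → Conf (suc N) → (Fin M → Fin N) → (Fin M → Fin nS) → Fin nS → Conf (suc N)
  afterBc c e E t₀ zero = t₀
  afterBc c e E t₀ (suc p) with any? (λ j → e j ≟ p)
  ... | yes (j , _) = E j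
  ... | no _        = proj₁ (bcastTotal (c (suc p)))

  bcTrans : ∀ {N M} (c : Conf (suc N)) (e : Fin M → Fin N) (E : Fin M → Fin nS) (t₀ : Fin nS) →
            Rel (c zero) bcast t₀ ≡ true → (∀ j → Rel (c (suc (e j))) bcast (E j) ≡ true) →
            Trans c (afterBc c e E t₀)
  bcTrans c e E t₀ move₀ moves = bc step
    where
    step : ∀ p → Rel (c p) bcast (afterBc c e E t₀ p) ≡ true
    step zero = move₀
    step (suc p) with any? (λ j → e j ≟ p)
    ... | yes (j , refl) = moves j
    ... | no _           = proj₂ (bcastTotal (c (suc p)))

  afterBc-helper : ∀ {N M} (c : Conf (suc N)) {e : Fin M → Fin N} E t₀ → Injective _≡_ _≡_ e →
                   ∀ j → afterBc c e E t₀ (suc (e j)) ≡ E j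
  afterBc-helper c {e} E t₀ e-inj j with any? (λ j' → e j' ≟ e j)
  ... | yes (j' , eq) = cong E (e-inj eq)
  ... | no none       = ⊥-elim (none (j , refl))

module Gatherings {k nA : ℕ} (P : RBTemplate k nA) where
  open RBTemplate P
  open RB P
  open Unwinding P using (SReach; base; step)
  open Systems P

  Partners : (Fin nS → Set) → Fin nA → Fin k → Set
  Partners Ini a h = ∀ l → l ≢ h → ∃[ s' ] ∃[ t' ] (Rel s' (rdz a l) t' ≡ true × SReach Ini s')

  module Rendezvous {Ini : Fin nS → Set} {a : Fin nA} {h : Fin k} {s t : Fin nS}
                    (move : Rel s (rdz a h) t ≡ true) (partners : Partners Ini a h) where

    fromD toD : (l : Fin k) → Dec (l ≡ h) → Fin nS
    fromD _ (yes _)   = s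
    fromD l (no l≢h)  = proj₁ (partners l l≢h)
    toD _ (yes _)   = t
    toD l (no l≢h)  = proj₁ (proj₂ (partners l l≢h))

    from to : Fin k → Fin nS
    from l = fromD l (l ≟ h)
    to l = toD l (l ≟ h)

    moves : ∀ l → Rel (from l) (rdz a l) (to l) ≡ true
    moves l with l ≟ h
    ... | yes refl = move
    ... | no l≢h   = proj₁ (proj₂ (proj₂ (partners l l≢h)))

    from-reach : SReach Ini s → ∀ l → SReach Ini (from l)
    from-reach reach l with l ≟ h
    ... | yes _  = reach
    ... | no l≢h = proj₂ (proj₂ (proj₂ (partners l l≢h)))

    to-h : to h ≡ t
    to-h with h ≟ h
    ... | yes _  = refl
    ... | no h≢h = ⊥-elim (h≢h refl)

  -- Helper j is process suc (e j); process 1 is never a helper.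
  Placed : ∀ {N M} → Conf (suc N) → (Fin M → Fin N) → (Fin M → Fin nS) → Set
  Placed c e D = ∀ j → c (suc (e j)) ≡ D j

  record Gathering {N M M'} (c : Conf (suc N)) (e : Fin M' → Fin N) (D : Fin M → Fin nS) : Set where
    field
      target           : Conf (suc N)
      path             : Path c target
      path-silent      : projPath path ≡ []
      untouched        : ∀ p → (∀ j → p ≢ suc (e j)) → target p ≡ c p
      chosen           : Fin M → Fin N
      chosen-injective : Injective _≡_ _≡_ chosen
      chosen-placed    : Placed target chosen D
      chosen-helpers   : ∀ j → ∃[ j' ] chosen j ≡ e j'

  record Gatherable (Ini : Fin nS → Set) {M} (D : Fin M → Fin nS) : Set where
    field
      size      : ℕ
      seeds     : Fin size → Fin nS
      seeds∈Ini : ∀ j → Ini (seeds j)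
      gather    : ∀ {N} (c : Conf (suc N)) (e : Fin size → Fin N) → Injective _≡_ _≡_ e →
                  Placed c e seeds → Gathering c e D

  open Gathering

  gathering-◅◅ : ∀ {N M M'} {c d : Conf (suc N)} {e : Fin M' → Fin N} {D : Fin M → Fin nS}
                 (g : Gathering c e D) (π : Path (target g) d) →
                 edgeLabels (c zero) (projPath (path g ◅◅ π)) ≡ edgeLabels (target g zero) (projPath π)
  gathering-◅◅ g π =
    cong₂ edgeLabels (sym (untouched g zero (λ _ ()))) (projPath-◅◅-silent (path g) π (path-silent g))

  gathering-++ : ∀ {N M₁ M₂ A₁ A₂} {c : Conf (suc N)} {e : Fin (A₁ + A₂) → Fin N}
                   {D₁ : Fin M₁ → Fin nS} {D₂ : Fin M₂ → Fin nS} → Injective _≡_ _≡_ e →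
                 (g₁ : Gathering c (λ i → e (i ↑ˡ A₂)) D₁) →
                 Gathering (target g₁) (λ i → e (A₁ ↑ʳ i)) D₂ →
                 Gathering c e (D₁ ++ᵛ D₂)
  gathering-++ {M₁ = M₁} {A₁ = A₁} {A₂} {e = e} {D₁} {D₂} e-inj g₁ g₂ = record
    { target           = target g₂
    ; path             = path g₁ ◅◅ path g₂
    ; path-silent      = trans (projPath-◅◅-silent (path g₁) (path g₂) (path-silent g₁)) (path-silent g₂)
    ; untouched        = λ p free → trans (untouched g₂ p (λ j → free (A₁ ↑ʳ j)))
                                          (untouched g₁ p (λ j → free (j ↑ˡ A₂)))
    ; chosen           = chosen g₁ ++ᵛ chosen g₂
    ; chosen-injective = ++ᵛ-injective (chosen-injective g₁) (chosen-injective g₂) chosen-apart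
    ; chosen-placed    = placed
    ; chosen-helpers   = helpers }
    where
    apart : ∀ a b → e (a ↑ˡ A₂) ≢ e (A₁ ↑ʳ b)
    apart a b eq = ↑ˡ≢↑ʳ a b (e-inj eq)

    first-apart : ∀ a b → chosen g₁ a ≢ e (A₁ ↑ʳ b)
    first-apart a b eq with chosen-helpers g₁ a
    ... | a' , chosen≡ = apart a' b (trans (sym chosen≡) eq)

    chosen-apart : ∀ a b → chosen g₁ a ≢ chosen g₂ b
    chosen-apart a b eq with chosen-helpers g₂ b
    ... | b' , chosen≡ = first-apart a b' (trans eq chosen≡)

    placed : Placed (target g₂) (chosen g₁ ++ᵛ chosen g₂) (D₁ ++ᵛ D₂)
    placed j with splitAt M₁ j
    ... | inj₁ a = trans (untouched g₂ _ (λ b eq → first-apart a b (suc-injective eq))) (chosen-placed g₁ a)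
    ... | inj₂ b = chosen-placed g₂ b

    helpers : ∀ j → ∃[ j' ] (chosen g₁ ++ᵛ chosen g₂) j ≡ e j'
    helpers j with splitAt M₁ j
    ... | inj₁ a = let a' , eq = chosen-helpers g₁ a in a' ↑ˡ A₂ , eq
    ... | inj₂ b = let b' , eq = chosen-helpers g₂ b in A₁ ↑ʳ b' , eq

  gathering-fire : ∀ {N M'} {c : Conf (suc N)} {e : Fin M' → Fin N} {a} {src tgt : Fin k → Fin nS} →
                   (∀ l → Rel (src l) (rdz a l) (tgt l) ≡ true) → Gathering c e src →
                   (h : Fin k) → Gathering c e (λ (_ : Fin 1) → tgt h)
  gathering-fire {c = c} {e} {src = src} {tgt} moves g h = record
    { target           = afterRdz (target g) ι tgt
    ; path             = path g ◅◅ (fire ◅ ε)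
    ; path-silent      = trans (projPath-◅◅-silent (path g) (fire ◅ ε) (path-silent g))
                               (cong (_?∷ []) (rdzTrans-silent (target g) ι-inj (chosen-placed g) moves λ _ ()))
    ; untouched        = λ p free → trans (afterRdz-bystander (target g) tgt p (λ l eq → outside p free l (sym eq)))
                                          (untouched g p free)
    ; chosen           = λ _ → chosen g h
    ; chosen-injective = λ { {zero} {zero} _ → refl }
    ; chosen-placed    = λ _ → afterRdz-participant (target g) tgt ι-inj h
    ; chosen-helpers   = λ _ → chosen-helpers g h }
    where
    ι : Fin k → Fin (suc _)
    ι = suc ∘ chosen g

    ι-inj : Injective _≡_ _≡_ ι
    ι-inj eq = chosen-injective g (suc-injective eq)

    fire : Trans (target g) (afterRdz (target g) ι tgt)
    fire = rdzTrans (target g) ι-inj (chosen-placed g) moves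

    outside : ∀ p → (∀ j → p ≢ suc (e j)) → ∀ l → p ≢ ι l
    outside p free l p≡ with chosen-helpers g l
    ... | j , chosen≡ = free j (trans p≡ (cong suc chosen≡))

  module _ {Ini : Fin nS → Set} where

    gatherable-map : ∀ {M M'} {D : Fin M → Fin nS} {D' : Fin M' → Fin nS} →
                     (∀ {N S} {c : Conf (suc N)} {e : Fin S → Fin N} → Gathering c e D → Gathering c e D') →
                     Gatherable Ini D → Gatherable Ini D'
    gatherable-map f G = record
      { size = size ; seeds = seeds ; seeds∈Ini = seeds∈Ini
      ; gather = λ c e e-inj placed → f (gather c e e-inj placed) }
      where open Gatherable G

    gatherable-cong : ∀ {M} {D D' : Fin M → Fin nS} → (∀ j → D j ≡ D' j) →
                      Gatherable Ini D → Gatherable Ini D'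
    gatherable-cong D≗D' = gatherable-map λ g → record
      { target = target g ; path = path g ; path-silent = path-silent g ; untouched = untouched g
      ; chosen = chosen g ; chosen-injective = chosen-injective g
      ; chosen-placed = λ j → trans (chosen-placed g j) (D≗D' j) ; chosen-helpers = chosen-helpers g }

    gatherable-single : ∀ {t} → Ini t → Gatherable Ini (λ (_ : Fin 1) → t)
    gatherable-single {t} t∈Ini = record
      { size = 1 ; seeds = λ _ → t ; seeds∈Ini = λ _ → t∈Ini
      ; gather = λ c e e-inj placed → record
          { target = c ; path = ε ; path-silent = refl ; untouched = λ _ _ → refl
          ; chosen = e ; chosen-injective = e-inj ; chosen-placed = placed ; chosen-helpers = λ j → j , refl } }

    gatherable-none : Gatherable Ini {0} (λ ())
    gatherable-none = record
      { size = 0 ; seeds = λ () ; seeds∈Ini = λ ()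
      ; gather = λ c e _ _ → record
          { target = c ; path = ε ; path-silent = refl ; untouched = λ _ _ → refl
          ; chosen = λ () ; chosen-injective = λ { {()} } ; chosen-placed = λ () ; chosen-helpers = λ () } }

    gatherable-++ : ∀ {M₁ M₂} {D₁ : Fin M₁ → Fin nS} {D₂ : Fin M₂ → Fin nS} →
                    Gatherable Ini D₁ → Gatherable Ini D₂ → Gatherable Ini (D₁ ++ᵛ D₂)
    gatherable-++ G₁ G₂ = record
      { size = G₁.size + G₂.size
      ; seeds = G₁.seeds ++ᵛ G₂.seeds
      ; seeds∈Ini = seeds∈Ini
      ; gather = gather }
      where
      module G₁ = Gatherable G₁
      module G₂ = Gatherable G₂

      seeds∈Ini : ∀ j → Ini ((G₁.seeds ++ᵛ G₂.seeds) j)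
      seeds∈Ini j with splitAt G₁.size j
      ... | inj₁ a = G₁.seeds∈Ini a
      ... | inj₂ b = G₂.seeds∈Ini b

      gather : ∀ {N} (c : Conf (suc N)) e → Injective _≡_ _≡_ e → Placed c e (G₁.seeds ++ᵛ G₂.seeds) →
               Gathering c e _
      gather c e e-inj placed = gathering-++ e-inj g₁ g₂
        where
        g₁ = G₁.gather c (λ a → e (a ↑ˡ G₂.size)) (λ eq → ↑ˡ-injective G₂.size _ _ (e-inj eq))
                       (λ a → trans (placed (a ↑ˡ G₂.size)) (lookup-++ˡ G₁.seeds G₂.seeds a))
        g₂ = G₂.gather (target g₁) (λ b → e (G₁.size ↑ʳ b))
                       (λ eq → ↑ʳ-injective G₁.size _ _ (e-inj eq))
                       (λ b → trans (untouched g₁ _ (λ a eq → ↑ˡ≢↑ʳ a b (e-inj (suc-injective (sym eq)))))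
                                    (trans (placed (G₁.size ↑ʳ b)) (lookup-++ʳ G₁.seeds G₂.seeds b)))

    gatherable-all : ∀ {M} (D : Fin M → Fin nS) → (∀ j → Gatherable Ini (λ (_ : Fin 1) → D j)) →
                     Gatherable Ini D
    gatherable-all {zero}  D Gs = gatherable-cong (λ ()) gatherable-none
    gatherable-all {suc M} D Gs = gatherable-cong (λ { zero → refl ; (suc _) → refl })
      (gatherable-++ (Gs zero) (gatherable-all (D ∘ suc) (Gs ∘ suc)))

    -- Unfold the derivation of t ∈ S: gather the k sources of its last rendezvous, then fire it.
    gatherable-reach : ∀ {t} → SReach Ini t → Gatherable Ini (λ (_ : Fin 1) → t)
    gatherable-reach (base t∈Ini) = gatherable-single t∈Ini
    gatherable-reach (step a h move reach-s partners) =
      gatherable-cong (λ _ → to-h)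
        (gatherable-map (λ g → gathering-fire moves g h) (gatherable-all from (λ l → from-gatherable l (l ≟ h))))
      where
      open Rendezvous move partners

      from-gatherable : ∀ l d → Gatherable Ini (λ (_ : Fin 1) → fromD l d)
      from-gatherable l (yes _)  = gatherable-reach reach-s
      from-gatherable l (no l≢h) = gatherable-reach (proj₂ (proj₂ (proj₂ (partners l l≢h))))

module UnwindingPaths {k nA : ℕ} (P : RBTemplate k nA) (m n : ℕ) where
  open RBTemplate P
  open Unwinding P
  open IndexedPaths

  P⊸ : LTS k nA (Subset nAP)
  P⊸ = Unwound m n

  U : Set
  U = UState m n

  UStep : U → U → Set
  UStep x y = ∃[ σ ] UEdge m n x σ y

  unwoundLabels : ∀ {x y} → Star UStep x y → List (Subset nAP)
  unwoundLabels q = map (lab ∘ UState.s) (states q)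

  -- Edges of P^⊸ only depend on the P-state and the phase index of their ends.
  record _≈_ (x y : U) : Set where
    constructor _,_
    field
      s≡   : UState.s x ≡ UState.s y
      idx≡ : UState.idx x ≡ UState.idx y

  ≈-sym : ∀ {x y} → x ≈ y → y ≈ x
  ≈-sym (s≡ , i≡) = sym s≡ , sym i≡

  ≈-trans : ∀ {x y z} → x ≈ y → y ≈ z → x ≈ z
  ≈-trans (s≡ , i≡) (s≡' , i≡') = trans s≡ s≡' , trans i≡ i≡'

  UEdge-respˡ : ∀ {x x' σ y} → x ≈ x' → UEdge m n x σ y → UEdge m n x' σ y
  UEdge-respˡ {record { s = s ; idx = i }} {record { s = .s ; idx = .i }} (refl , refl) (rdzE i≡ r)  = rdzE i≡ r
  UEdge-respˡ {record { s = s ; idx = i }} {record { s = .s ; idx = .i }} (refl , refl) (bcE move c) = bcE move c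

  UEdge-respʳ : ∀ {x σ y y'} → y ≈ y' → UEdge m n x σ y → UEdge m n x σ y'
  UEdge-respʳ {y = record { s = s ; idx = i }} {record { s = .s ; idx = .i }} (refl , refl) (rdzE i≡ r)  = rdzE i≡ r
  UEdge-respʳ {y = record { s = s ; idx = i }} {record { s = .s ; idx = .i }} (refl , refl) (bcE move c) = bcE move c

  retarget : ∀ {x x' y} → x ≈ x' → (q : Star UStep x y) →
             ∃ λ y' → Σ (Star UStep x' y') λ q' → unwoundLabels q' ≡ unwoundLabels q
  retarget (s≡ , _) ε = _ , ε , cong (λ s → lab s ∷ []) (sym s≡)
  retarget x≈x' ((σ , e) ◅ q) =
    _ , (σ , UEdge-respˡ x≈x' e) ◅ q , cong (λ s → lab s ∷ unwoundLabels q) (sym (_≈_.s≡ x≈x'))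

  pathOfFinRun : (π : FinRun P⊸) → Star UStep (FinRun.st π 0) (FinRun.st π (FinRun.len π))
  pathOfFinRun π = fromIndexed len st (λ i → FinRun.sym π (toℕ i) , edge i)
    where open FinRun π using (len; st; edge)

  unwoundLabels-pathOfFinRun : (π : FinRun P⊸) → unwoundLabels (pathOfFinRun π) ≡ finLabels P⊸ π
  unwoundLabels-pathOfFinRun π =
    trans (cong (map (lab ∘ UState.s)) (states-fromIndexed len st _))
          (trans (map-applyUpTo st (lab ∘ UState.s) (suc len))
                 (sym (map-applyUpTo id (lab ∘ UState.s ∘ st) (suc len))))
    where open FinRun π using (len; st)

  symAt : ∀ {x y} → Star UStep x y → ℕ → Sym k nA
  symAt ε               _       = bcast
  symAt ((σ , _) ◅ _)   zero    = σ
  symAt (_ ◅ q)         (suc i) = symAt q i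

  edgeAt : ∀ {x y} (q : Star UStep x y) (i : Fin (length q)) →
           UEdge m n (stateAt q (toℕ i)) (symAt q (toℕ i)) (stateAt q (suc (toℕ i)))
  edgeAt ((_ , e) ◅ ε)       zero    = e
  edgeAt ((_ , e) ◅ (_ ◅ _)) zero    = e
  edgeAt (_ ◅ q)             (suc i) = edgeAt q i

  finRunOfPath : ∀ {x y} → LTS.IsInit P⊸ x → Star UStep x y → FinRun P⊸
  finRunOfPath x-init q = record
    { len = length q ; st = stateAt q ; sym = symAt q
    ; init = subst (LTS.IsInit P⊸) (sym (stateAt-0 q)) x-init ; edge = edgeAt q }

  finLabels-finRunOfPath : ∀ {x y} (x-init : LTS.IsInit P⊸ x) (q : Star UStep x y) →
                           finLabels P⊸ (finRunOfPath x-init q) ≡ unwoundLabels q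
  finLabels-finRunOfPath x-init q =
    trans (map-applyUpTo id (lab ∘ UState.s ∘ stateAt q) (suc (length q)))
          (sym (trans (cong (map (lab ∘ UState.s)) (sym (states-stateAt q)))
                      (map-applyUpTo (stateAt q) (lab ∘ UState.s) (suc (length q)))))

module Soundness {k nA : ℕ} (P : RBTemplate k nA) (m n : ℕ) (n≤m : n ≤ m)
                 (wrap : ∀ s → Unwinding.ISet P (suc m) s → Unwinding.ISet P n s) where
  open RBTemplate P
  open RB P
  open Unwinding P
  open Systems P
  open UnwindingPaths P m n

  record Phase {N} (c : Conf (suc N)) : Set where
    constructor phase
    field
      index   : ℕ
      index≤m : index ≤ m
      reach   : ∀ p → SSet index (c p)

  unwoundState : ∀ {N} {c : Conf (suc N)} → Phase c → U
  unwoundState {c = c} (phase i i≤m reach) = record { s = c zero ; idx = i ; idx≤m = i≤m ; inS = reach zero }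

  initialPhase : ∀ {N} {c : Conf (suc N)} → IsInitConf c → Phase c
  initialPhase ini = phase 0 z≤n (λ p → base (ini p))

  record StepSimulation {N} {c c' : Conf (suc N)} (φ : Phase c) (t : Trans c c') : Set where
    field
      next   : Phase c'
      silent : move1 t ≡ nothing → unwoundState next ≈ unwoundState φ
      loud   : ∀ σ → move1 t ≡ just σ → UEdge m n (unwoundState φ) σ (unwoundState next)

  simulateStep : ∀ {N} {c c' : Conf (suc N)} (φ : Phase c) (t : Trans c c') → StepSimulation φ t
  simulateStep {c = c} (phase i i≤m reach) (bc moves) with m≤n⇒m<n∨m≡n i≤m
  ... | inj₁ i<m = record
    { next   = phase (suc i) i<m (λ p → base (c p , reach p , moves p))
    ; silent = λ ()
    ; loud   = λ { _ refl → bcE (moves zero) (inj₁ (i<m , refl)) } }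
  ... | inj₂ refl = record
    { next   = phase n n≤m (λ p → base (wrap _ (c p , reach p , moves p)))
    ; silent = λ ()
    ; loud   = λ { _ refl → bcE (moves zero) (inj₂ (refl , refl)) } }
  simulateStep {c = c} {c'} (phase i i≤m reach) (rz a ι ι-inj moves frame) = record
    { next   = phase i i≤m reach'
    ; silent = λ quiet → frame zero (move1≡nothing⇒absent a ι ι-inj moves frame quiet) , refl
    ; loud   = loud }
    where
    partners : ∀ h l → l ≢ h → ∃[ s' ] ∃[ t' ] (Rel s' (rdz a l) t' ≡ true × SSet i s')
    partners _ l _ = c (ι l) , c' (ι l) , moves l , reach (ι l)

    reach' : ∀ p → SSet i (c' p)
    reach' p with any? (λ j → ι j ≟ p)
    ... | yes (j , refl) = step a j (moves j) (reach (ι j)) (partners j)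
    ... | no none        = subst (SSet i) (sym (frame p (λ j eq → none (j , eq)))) (reach p)

    loud : ∀ σ → move1 (rz a ι ι-inj moves frame) ≡ just σ →
           UEdge m n (unwoundState (phase i i≤m reach)) σ (unwoundState (phase i i≤m reach'))
    loud σ moved with move1≡just⇒participant a ι ι-inj moves frame moved
    ... | j , ι≡0 , refl = rdzE refl
      (a , j , refl , subst (λ p → Rel (c p) (rdz a j) (c' p) ≡ true) ι≡0 (moves j) , reach zero , partners j)

  simulatePath : ∀ {N} {c d : Conf (suc N)} (φ : Phase c) (π : Path c d) →
                 ∃ λ y → Σ (Star UStep (unwoundState φ) y) λ q →
                   unwoundLabels q ≡ edgeLabels (c zero) (projPath π)
  simulatePath φ ε = _ , ε , refl
  simulatePath {c = c} φ (t ◅ π) with simulateStep φ t | move1 t in moved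
  ... | S | just σ =
    let y , q , q≡ = simulatePath (StepSimulation.next S) π
    in y , (σ , StepSimulation.loud S σ moved) ◅ q , cong (lab (c zero) ∷_) q≡
  ... | S | nothing =
    let y , q , q≡ = simulatePath (StepSimulation.next S) π
        still = StepSimulation.silent S moved
        y' , q' , q'≡ = retarget still q
    in y' , q' , trans q'≡ (trans q≡ (cong (λ s → edgeLabels s (projPath π)) (_≈_.s≡ still)))

  simulateFinRun : ∀ {N} (ρ : SysFinRun N) → Σ (FinRun P⊸) λ π → finLabels P⊸ π ≡ finProjLabels ρ
  simulateFinRun ρ =
    let open SysFinRun ρ
        _ , q , q≡ = simulatePath (initialPhase init) (pathOfRun ρ)
    in finRunOfPath (refl , init zero) q
     , trans (finLabels-finRunOfPath (refl , init zero) q)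
             (trans q≡ (cong (edgeLabels (conf 0 zero)) (projPath-pathOfRun ρ)))

  module SimulateInfRun {N} (ρ : SysInfRun N) where
    open SysInfRun ρ

    phaseAt : ∀ i → Phase (conf i)
    phaseAt zero    = initialPhase init
    phaseAt (suc i) = StepSimulation.next (simulateStep (phaseAt i) (tr i))

    silent-stretch : ∀ {a b} → a ≤′ b → (∀ i → a ≤ i → i < b → move1 (tr i) ≡ nothing) →
                     unwoundState (phaseAt b) ≈ unwoundState (phaseAt a)
    silent-stretch ≤′-refl _ = refl , refl
    silent-stretch (≤′-step {b} a≤′b) quiet =
      ≈-trans (StepSimulation.silent (simulateStep (phaseAt b) (tr b)) (quiet b (≤′⇒≤ a≤′b) (n<1+n b)))
              (silent-stretch a≤′b (λ i a≤i i<b → quiet i a≤i (m<n⇒m<1+n i<b)))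

    module _ (idx : ℕ → ℕ) (idx-< : ∀ j → idx j < idx (suc j))
             (moves : ∀ j → ∃[ σ ] move1 (tr (idx j)) ≡ just σ)
             (others : ∀ i → (∀ j → idx j ≢ i) → move1 (tr i) ≡ nothing) where

      idx-mono : ∀ {j j'} → j ≤′ j' → idx j ≤ idx j'
      idx-mono ≤′-refl           = ≤-refl
      idx-mono (≤′-step {j'} le) = ≤-trans (idx-mono le) (<⇒≤ (idx-< j'))

      between-silent : ∀ j i → idx j < i → i < idx (suc j) → move1 (tr i) ≡ nothing
      between-silent j i lo hi = others i not-index
        where
        not-index : ∀ j' → idx j' ≢ i
        not-index j' refl with j' ≤? j
        ... | yes j'≤j = ≤⇒≯ (idx-mono (≤⇒≤′ j'≤j)) lo
        ... | no j'≰j  = ≤⇒≯ (idx-mono (≤⇒≤′ (≰⇒> j'≰j))) hi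

      before-silent : ∀ i → i < idx 0 → move1 (tr i) ≡ nothing
      before-silent i hi = others i λ { j' refl → ≤⇒≯ (idx-mono (≤⇒≤′ z≤n)) hi }

      run : InfRun P⊸
      run = record
        { st   = λ j → unwoundState (phaseAt (idx j))
        ; sym  = λ j → proj₁ (moves j)
        ; init = _≈_.idx≡ start , subst (λ s → Init s ≡ true) (sym (_≈_.s≡ start)) (init zero)
        ; edge = λ j → UEdge-respʳ
            (≈-sym (silent-stretch (≤⇒≤′ (idx-< j)) (λ i lo hi → between-silent j i lo hi)))
            (StepSimulation.loud (simulateStep (phaseAt (idx j)) (tr (idx j))) _ (proj₂ (moves j))) }
        where
        start = silent-stretch (≤⇒≤′ z≤n) (λ i _ hi → before-silent i hi)

module Completeness {k nA : ℕ} (P : RBTemplate k nA) (m n : ℕ)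
                    (unwrap : ∀ s → Unwinding.ISet P n s → Unwinding.ISet P (suc m) s) where
  open RBTemplate P
  open RB P
  open Unwinding P
  open Systems P
  open Gatherings P
  open Gathering
  open UnwindingPaths P m n

  Realises : ∀ {N} {x y : U} → Conf (suc N) → Star UStep x y → Set
  Realises c q = ∃ λ d → Σ (Path c d) λ π → edgeLabels (c zero) (projPath π) ≡ unwoundLabels q

  record Realisation {x y : U} (q : Star UStep x y) : Set where
    field
      size          : ℕ
      helpers       : Fin size → Fin nS
      helpers-reach : ∀ j → SSet (UState.idx x) (helpers j)
      realise       : ∀ {N} (c : Conf (suc N)) (e : Fin size → Fin N) → Injective _≡_ _≡_ e →
                      Placed c e helpers → c zero ≡ UState.s x → Realises c q

  realises-after-gathering : ∀ {N M M'} {c : Conf (suc N)} {e : Fin M' → Fin N} {D : Fin M → Fin nS}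
                               {x y} {q : Star UStep x y} (g : Gathering c e D) → Realises (target g) q → Realises c q
  realises-after-gathering g (d , π , π≡) = d , path g ◅◅ π , trans (gathering-◅◅ g π) π≡

  seeding : ∀ {x y} {q : Star UStep x y} (R : Realisation q) →
            Gatherable (ISet (UState.idx x)) (Realisation.helpers R)
  seeding R = gatherable-all helpers (λ j → gatherable-reach (helpers-reach j)) where open Realisation R

  realise-seeded : ∀ {x y} {q : Star UStep x y} (R : Realisation q) {N} (c : Conf (suc N)) e →
                   Injective _≡_ _≡_ e → Placed c e (Gatherable.seeds (seeding R)) → c zero ≡ UState.s x →
                   Realises c q
  realise-seeded R c e e-inj placed c0 = realises-after-gathering g
    (Realisation.realise R (target g) (chosen g) (chosen-injective g) (chosen-placed g)
                         (trans (untouched g zero (λ _ ())) c0))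
    where g = Gatherable.gather (seeding R) c e e-inj placed

  broadcastSource : ∀ {i j t} → (i < m × j ≡ suc i) ⊎ (i ≡ m × j ≡ n) → ISet j t → ISet (suc i) t
  broadcastSource (inj₁ (_ , refl))    t∈I = t∈I
  broadcastSource (inj₂ (refl , refl)) t∈I = unwrap _ t∈I

  -- Before the broadcast, helper j waits in a 𝔟-predecessor of the j-th seed of q's helpers.
  realise-bc : ∀ {x y z} {q : Star UStep y z} (move : Rel (UState.s x) bcast (UState.s y) ≡ true) cond →
               Realisation q → Realisation {x} ((bcast , bcE move cond) ◅ q)
  realise-bc {x} {y} {q = q} move cond R = record
    { size = G.size ; helpers = proj₁ ∘ before ; helpers-reach = proj₁ ∘ proj₂ ∘ before ; realise = go }
    where
    module G = Gatherable (seeding R)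

    before : ∀ j → ISet (suc (UState.idx x)) (G.seeds j)
    before j = broadcastSource cond (G.seeds∈Ini j)

    go : ∀ {N} (c : Conf (suc N)) e → Injective _≡_ _≡_ e → Placed c e (proj₁ ∘ before) →
         c zero ≡ UState.s x → Realises {x = x} c ((bcast , bcE move cond) ◅ q)
    go c e e-inj placed c0 =
      let d , π , π≡ = realise-seeded R (afterBc c e G.seeds (UState.s y)) e e-inj
                                      (afterBc-helper c G.seeds (UState.s y) e-inj) refl
      in d , shout ◅ π , cong₂ _∷_ (cong lab c0) π≡
      where
      shout = bcTrans c e G.seeds (UState.s y) (subst (λ s → Rel s bcast (UState.s y) ≡ true) (sym c0) move)
                (λ j → subst (λ s → Rel s bcast (G.seeds j) ≡ true) (sym (placed j)) (proj₂ (proj₂ (before j))))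

  -- Helpers 0 … k-1 serve as partners in the slots l ≢ h; helper h stays idle, process 1 taking its slot.
  realise-rdz : ∀ {x y z σ} {q : Star UStep y z} (i≡ : UState.idx y ≡ UState.idx x)
                  (r : REdge (ISet (UState.idx x)) (UState.s x) σ (UState.s y)) →
                Realisation q → Realisation {x} ((σ , rdzE i≡ r) ◅ q)
  realise-rdz {x} {y} {q = q} i≡ (a , h , refl , move , reach-x , partners) R = record
    { size = k + R.size ; helpers = from ++ᵛ R.helpers ; helpers-reach = helpers-reach ; realise = go }
    where
    module R = Realisation R
    open Rendezvous move partners

    helpers-reach : ∀ j → SSet (UState.idx x) ((from ++ᵛ R.helpers) j)
    helpers-reach j with splitAt k j
    ... | inj₁ l = from-reach reach-x l
    ... | inj₂ b = subst (λ i → SSet i (R.helpers b)) i≡ (R.helpers-reach b)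

    go : ∀ {N} (c : Conf (suc N)) e → Injective _≡_ _≡_ e → Placed c e (from ++ᵛ R.helpers) →
         c zero ≡ UState.s x →
         Realises {x = x} c ((rdz a h , rdzE i≡ (a , h , refl , move , reach-x , partners)) ◅ q)
    go {N} c e e-inj placed c0 =
      let d , π , π≡ = R.realise c' (λ b → e (k ↑ʳ b)) (λ eq → ↑ʳ-injective k _ _ (e-inj eq))
                                 placed' (trans (cong c' (sym ι-h)) (trans (afterRdz-participant c to ι-inj h) to-h))
          _ , moved = rdzTrans-moves1 c ι-inj at moves h ι-h
      in d , fire ◅ π
       , trans (cong (λ o → edgeLabels (c zero) (o ?∷ projPath π)) (edge1-loud fire moved))
               (cong₂ _∷_ (cong lab c0) π≡)
      where
      ιD : ∀ l → Dec (l ≡ h) → Fin (suc N)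
      ιD _ (yes _) = zero
      ιD l (no _)  = suc (e (l ↑ˡ R.size))

      ι : Fin k → Fin (suc N)
      ι l = ιD l (l ≟ h)

      ι-h : ι h ≡ zero
      ι-h with h ≟ h
      ... | yes _  = refl
      ... | no h≢h = ⊥-elim (h≢h refl)

      ιD-injective : ∀ l l' d d' → ιD l d ≡ ιD l' d' → l ≡ l'
      ιD-injective l l' (yes refl) (yes refl) _  = refl
      ιD-injective l l' (no _)     (no _)     eq = ↑ˡ-injective R.size l l' (e-inj (suc-injective eq))

      ι-inj : Injective _≡_ _≡_ ι
      ι-inj {l} {l'} = ιD-injective l l' (l ≟ h) (l' ≟ h)

      atD : ∀ l d → c (suc (e (l ↑ˡ R.size))) ≡ fromD l d → c (ιD l d) ≡ fromD l d
      atD _ (yes _) _  = c0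
      atD _ (no _)  at = at

      at : ∀ l → c (ι l) ≡ from l
      at l = atD l (l ≟ h) (trans (placed (l ↑ˡ R.size)) (lookup-++ˡ from R.helpers l))

      fire = rdzTrans c ι-inj at moves
      c' = afterRdz c ι to

      not-participant : ∀ b l d → ιD l d ≢ suc (e (k ↑ʳ b))
      not-participant b l (no _) eq = ↑ˡ≢↑ʳ l b (e-inj (suc-injective eq))

      placed' : Placed c' (λ b → e (k ↑ʳ b)) R.helpers
      placed' b = trans (afterRdz-bystander c to _ (λ l → not-participant b l (l ≟ h)))
                        (trans (placed (k ↑ʳ b)) (lookup-++ʳ from R.helpers b))

  realise : ∀ {x y} (q : Star UStep x y) → Realisation q
  realise ε = record
    { size = 0 ; helpers = λ () ; helpers-reach = λ ()
    ; realise = λ c _ _ _ c0 → c , ε , cong (λ s → lab s ∷ []) c0 }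
  realise ((_ , rdzE i≡ r) ◅ q)     = realise-rdz i≡ r (realise q)
  realise ((_ , bcE move cond) ◅ q) = realise-bc move cond (realise q)

  realiseFinRun : (π : FinRun P⊸) → Σ ℕ λ N → Σ (SysFinRun N) λ ρ → finProjLabels ρ ≡ finLabels P⊸ π
  realiseFinRun π =
    let _ , path , path≡ = realise-seeded R c id (λ eq → eq) (λ _ → refl) refl
    in G.size , runOfPath initial path
     , trans (finProjLabels-runOfPath initial path) (trans path≡ (unwoundLabels-pathOfFinRun π))
    where
    open FinRun π
    R = realise (pathOfFinRun π)
    module G = Gatherable (seeding R)

    c : Conf (suc G.size)
    c zero    = UState.s (st 0)
    c (suc j) = G.seeds j

    initial : IsInitConf c
    initial zero    = proj₂ init
    initial (suc j) = subst (λ i → ISet i (G.seeds j)) (proj₁ init) (G.seeds∈Ini j)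

proposition5p9 :
    (k nA : ℕ) → 1 ≤ k → (P : RBTemplate k nA) → (m n : ℕ)
      → Unwinding.IsLoopPoint P m n
      → ((w : List (RB.Lab P))
           → (RB.ExecFin P w
               → Σ (FinRun (Unwinding.Unwound P m n)) (λ π → finLabels (Unwinding.Unwound P m n) π ≡ w))
           × (Σ (FinRun (Unwinding.Unwound P m n)) (λ π → finLabels (Unwinding.Unwound P m n) π ≡ w)
               → RB.ExecFin P w))
      × ((w : ℕ → RB.Lab P)
           → RB.ExecInf P w
           → Σ (InfRun (Unwinding.Unwound P m n)) (λ π → (i : ℕ) → infLabels (Unwinding.Unwound P m n) π i ≡ w i))
proposition5p9 k nA _ P m n (n≤m , I[m+1]≈I[n] , _) = (λ w → sound w , complete w) , soundInf
  where
  open RB P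
  open UnwindingPaths P m n using (P⊸)
  open Soundness P m n n≤m (λ s → proj₁ (I[m+1]≈I[n] s))
  open Completeness P m n (λ s → proj₂ (I[m+1]≈I[n] s))

  sound : ∀ w → ExecFin w → Σ (FinRun P⊸) λ π → finLabels P⊸ π ≡ w
  sound w (inj₁ (_ , ρ , ρ≡w))         = let π , π≡ρ = simulateFinRun ρ in π , trans π≡ρ ρ≡w
  sound w (inj₂ (_ , ρ , L , _ , ρ≡w)) = let π , π≡ρ = simulateFinRun (prefix ρ L) in π , trans π≡ρ ρ≡w

  complete : ∀ w → (Σ (FinRun P⊸) λ π → finLabels P⊸ π ≡ w) → ExecFin w
  complete w (π , π≡w) = let N , ρ , ρ≡π = realiseFinRun π in inj₁ (N , ρ , trans ρ≡π π≡w)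

  soundInf : ∀ w → ExecInf w → Σ (InfRun P⊸) λ π → ∀ i → infLabels P⊸ π i ≡ w i
  soundInf w (_ , ρ , idx , idx-< , moves , others , w≡) =
    SimulateInfRun.run ρ idx idx-< moves others , λ i → sym (w≡ i)
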